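{- Let $n\ge 1$ and let $\mathcal F$ be a finite multi-family of subsets of $[n]$ satisfying conditions (i) and (ii) below (equivalently, solving $P_n(?\rightarrow 1)$ with at most one lie). Then there is $j\in[n]$ such that $\{j\}$ is a member of $\mathcal F$ with multiplicity $u\ge 2$. (i) Every element of $[n]$ is contained in at least $3$ members of $\mathcal F$ (counted with multiplicity). (ii) For every partition of $\mathcal F$ into sub-multi-families $\mathcal F_1,\mathcal F_2$ with $|\mathcal F_1|\ge 2$, if the family $T^{*}(\mathcal F_1,\mathcal F_2)$ of all $T\subseteq[n]$ such that $T\cap F\neq\emptyset$ for $F\in\mathcal F_1$ and $T\cap G=\emptyset$ for $G\in\mathcal F_2$, with at most one exception among all members of $\mathcal F_1\cup\mathcal F_2$, is non-empty, then $\bigcap_{T\in T^{*}(\mathcal F_1,\mathcal F_2)}T\neq\emptyset$.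
   Context: A multi-family is a finite list of subsets of $[n]=\{1,\dots,n\}$ in which a set may occur several times; sizes and memberships are counted with multiplicity, and a partition of a multi-family may split the copies of a repeated set between the two parts. "With at most one exception" means that at most one member (counted with multiplicity) of $\mathcal F_1\cup\mathcal F_2$ fails its required condition. Problem $P_n(?\rightarrow 1)$ with at most one lie: find an element of an unknown set $T\subseteq[n]$ of excellent elements, or certify $T=\emptyset$, from YES/NO answers to "is $F\cap T\ne\emptyset$?" for all members $F$ of $\mathcal F$, where at most one answer is wrong. -}

module Defs where

open import Data.Nat using (ℕ)
open import Data.Bool using (Bool; true; false; not; if_then_else_)
open import Data.Fin using (Fin)
open import Data.Fin.Subset using (Subset; _∩_; _∈_; ∣_∣; ⁅_⁆)
open import Data.Fin.Subset.Properties using (nonempty?)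
open import Data.Vec using (tabulate; lookup)
open import Data.Vec.Properties using (≡-dec)
open import Data.Product using (∃)
open import Relation.Nullary.Decidable using (⌊_⌋)
open import Data.Bool.Properties renaming (_≟_ to _≟ᵇ_)
open import Data.Nat using (_≤_)

MultiFamily : ℕ → ℕ → Set
MultiFamily n m = Fin m → Subset n

meets : ∀ {n} → Subset n → Subset n → Bool
meets T S = ⌊ nonempty? (T ∩ S) ⌋

degree : ∀ {n m} → MultiFamily n m → Fin n → ℕ
degree F x = ∣ tabulate (λ i → lookup (F i) x) ∣

singletonMult : ∀ {n m} → MultiFamily n m → Fin n → ℕ
singletonMult {n} F j = ∣ tabulate (λ i → ⌊ ≡-dec _≟ᵇ_ (F i) ⁅ j ⁆ ⌋) ∣

-- A partition (F₁, F₂) of F is given by the set F₁ ⊆ Fin m of indices of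
-- members placed in F₁; the other members form F₂.
-- fails T F₁ F i = true iff member i violates its required condition:
--   i ∈ F₁ requires T ∩ F i ≠ ∅, i ∈ F₂ requires T ∩ F i = ∅.
fails : ∀ {n m} → MultiFamily n m → Subset m → Subset n → Fin m → Bool
fails F F₁ T i = if lookup F₁ i then not (meets T (F i)) else meets T (F i)

InTStar : ∀ {n m} → MultiFamily n m → Subset m → Subset n → Set
InTStar F F₁ T = ∣ tabulate (fails F F₁ T) ∣ ≤ 1

CondI : ∀ {n m} → MultiFamily n m → Set
CondI F = ∀ x → 3 ≤ degree F x

CondII : ∀ {n m} → MultiFamily n m → Set
CondII {n} {m} F = (F₁ : Subset m) → 2 ≤ ∣ F₁ ∣ →
  ∃ (λ (T : Subset n) → InTStar F F₁ T) →
  ∃ (λ (x : Fin n) → ∀ (T : Subset n) → InTStar F F₁ T → x ∈ T)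

-- Put every non-empty member into F₁ and every empty member into F₂.  Then T = [n]
-- satisfies all requirements, so T*(F₁, F₂) is non-empty, and |F₁| ≥ 2 by (i).  The set
-- [n] ∖ {x} violates exactly the requirements of the copies of {x} in F₁.  If every
-- singleton occurred at most once, every [n] ∖ {x} would lie in T*(F₁, F₂), whose
-- intersection would then be empty, contradicting (ii).
module Submission where

open import Defs
open import Data.Nat using (ℕ; _≤_; _≤?_; z≤n)
open import Data.Nat.Properties using (≤-trans; ≤-pred; ≰⇒>; n≤1+n)
open import Data.Fin using (Fin; fromℕ<)
open import Data.Fin.Properties using (any?)
open import Data.Fin.Subset using (Subset; _∩_; _∈_; _⊆_; ∣_∣; ⁅_⁆; ⊤; ∁; Nonempty)
open import Data.Fin.Subset.Properties
  using (nonempty?; Empty-unique; ∣⊥∣≡0; p⊆q⇒∣p∣≤∣q∣; ⊆-antisym; ∩-identityˡ;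
         x∈p∩q⁺; x∈p∩q⁻; x∈⁅x⁆; x∈⁅y⁆⇒x≡y; x∉∁p⇒x∈p; x∈∁p⇒x∉p; _∈?_)
open import Data.Vec using (tabulate)
open import Data.Vec.Properties using (≡-dec; lookup∘tabulate; []=⇒lookup; lookup⇒[]=)
open import Data.Bool using (Bool; true; false; not; if_then_else_)
open import Data.Bool.Properties using (not-injective) renaming (_≟_ to _≟ᵇ_)
open import Data.Product using (∃; _,_; proj₂)
open import Data.Empty using (⊥-elim)
open import Relation.Nullary using (¬_; Dec; yes; no; contradiction)
open import Relation.Nullary.Decidable using (⌊_⌋)
open import Relation.Binary.PropositionalEquality using (_≡_; refl; sym; trans; cong; subst)

∈-tabulate⁻ : ∀ {m} (f : Fin m → Bool) {i} → i ∈ tabulate f → f i ≡ true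
∈-tabulate⁻ f {i} i∈ = trans (sym (lookup∘tabulate f i)) ([]=⇒lookup i∈)

∈-tabulate⁺ : ∀ {m} (f : Fin m → Bool) {i} → f i ≡ true → i ∈ tabulate f
∈-tabulate⁺ f {i} fi = lookup⇒[]= i (tabulate f) (trans (lookup∘tabulate f i) fi)

∣tabulate∣-mono : ∀ {m} (f g : Fin m → Bool) → (∀ i → f i ≡ true → g i ≡ true) →
  ∣ tabulate f ∣ ≤ ∣ tabulate g ∣
∣tabulate∣-mono f g f⇒g =
  p⊆q⇒∣p∣≤∣q∣ λ {i} i∈ → ∈-tabulate⁺ g (f⇒g i (∈-tabulate⁻ f i∈))

∣tabulate∣≡0 : ∀ {m} (f : Fin m → Bool) → (∀ i → f i ≡ false) → ∣ tabulate f ∣ ≡ 0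
∣tabulate∣≡0 {m} f f≡false =
  trans (cong ∣_∣ (Empty-unique none)) (∣⊥∣≡0 m)
  where
  none : ¬ Nonempty (tabulate f)
  none (i , i∈) with trans (sym (f≡false i)) (∈-tabulate⁻ f i∈)
  ... | ()

⌊⌋≡true⁺ : ∀ {A : Set} (a? : Dec A) → A → ⌊ a? ⌋ ≡ true
⌊⌋≡true⁺ (yes _) _ = refl
⌊⌋≡true⁺ (no ¬a) a = contradiction a ¬a

⌊⌋≡true⁻ : ∀ {A : Set} (a? : Dec A) → ⌊ a? ⌋ ≡ true → A
⌊⌋≡true⁻ (yes a) _ = a

⌊⌋≡false⁻ : ∀ {A : Set} (a? : Dec A) → ⌊ a? ⌋ ≡ false → ¬ A
⌊⌋≡false⁻ (no ¬a) _ = ¬a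

if-not-self≡false : ∀ b → (if b then not b else b) ≡ false
if-not-self≡false true  = refl
if-not-self≡false false = refl

Nonempty-∩ʳ : ∀ {n} (p q : Subset n) → Nonempty (p ∩ q) → Nonempty q
Nonempty-∩ʳ p q (x , x∈) = x , proj₂ (x∈p∩q⁻ p q x∈)

Empty-∁∩⇒⊆ : ∀ {n} (p q : Subset n) → ¬ Nonempty (∁ p ∩ q) → q ⊆ p
Empty-∁∩⇒⊆ p q empty {x} x∈q with x ∈? ∁ p
... | yes x∈∁p = contradiction (x , x∈p∩q⁺ (x∈∁p , x∈q)) empty
... | no  x∉∁p = x∉∁p⇒x∈p x∉∁p

Nonempty-⊆⁅x⁆⇒≡⁅x⁆ : ∀ {n} (S : Subset n) (x : Fin n) → Nonempty S → S ⊆ ⁅ x ⁆ → S ≡ ⁅ x ⁆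
Nonempty-⊆⁅x⁆⇒≡⁅x⁆ S x (y , y∈S) S⊆⁅x⁆ = ⊆-antisym S⊆⁅x⁆ ⁅x⁆⊆S
  where
  ⁅x⁆⊆S : ⁅ x ⁆ ⊆ S
  ⁅x⁆⊆S z∈⁅x⁆ rewrite x∈⁅y⁆⇒x≡y x z∈⁅x⁆ | sym (x∈⁅y⁆⇒x≡y x (S⊆⁅x⁆ y∈S)) = y∈S

module _ {n m : ℕ} (F : MultiFamily n m) where

  nonemptyMembers : Subset m
  nonemptyMembers = tabulate (λ i → ⌊ nonempty? (F i) ⌋)

  private
    N : Subset m
    N = nonemptyMembers

    fails-unfold : ∀ T i → fails F N T i ≡
      (if ⌊ nonempty? (F i) ⌋ then not (meets T (F i)) else meets T (F i))
    fails-unfold T i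
      rewrite lookup∘tabulate (λ i → ⌊ nonempty? (F i) ⌋) i = refl

  fails-⊤≡false : ∀ i → fails F N ⊤ i ≡ false
  fails-⊤≡false i rewrite fails-unfold ⊤ i | ∩-identityˡ (F i) =
    if-not-self≡false ⌊ nonempty? (F i) ⌋

  fails-∁⁅x⁆⇒≡⁅x⁆ : ∀ x i → fails F N (∁ ⁅ x ⁆) i ≡ true → F i ≡ ⁅ x ⁆
  fails-∁⁅x⁆⇒≡⁅x⁆ x i failure rewrite fails-unfold (∁ ⁅ x ⁆) i
    with nonempty? (F i)
  ... | yes F≢∅ = Nonempty-⊆⁅x⁆⇒≡⁅x⁆ (F i) x F≢∅
        (Empty-∁∩⇒⊆ ⁅ x ⁆ (F i) (⌊⌋≡false⁻ (nonempty? _) (not-injective failure)))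
  ... | no F≡∅ =
        ⊥-elim (F≡∅ (Nonempty-∩ʳ (∁ ⁅ x ⁆) (F i) (⌊⌋≡true⁻ (nonempty? _) failure)))

  ⊤∈T* : InTStar F N ⊤
  ⊤∈T* = subst (_≤ 1) (sym (∣tabulate∣≡0 (fails F N ⊤) fails-⊤≡false)) z≤n

  ∁⁅x⁆∈T* : ∀ x → singletonMult F x ≤ 1 → InTStar F N (∁ ⁅ x ⁆)
  ∁⁅x⁆∈T* x mult≤1 = ≤-trans (∣tabulate∣-mono _ _ failure⇒singleton) mult≤1
    where
    failure⇒singleton : ∀ i → fails F N (∁ ⁅ x ⁆) i ≡ true →
      ⌊ ≡-dec _≟ᵇ_ (F i) ⁅ x ⁆ ⌋ ≡ true
    failure⇒singleton i failure =
      ⌊⌋≡true⁺ (≡-dec _≟ᵇ_ (F i) ⁅ x ⁆) (fails-∁⁅x⁆⇒≡⁅x⁆ x i failure)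

  degree≤∣nonemptyMembers∣ : ∀ x → degree F x ≤ ∣ N ∣
  degree≤∣nonemptyMembers∣ x = ∣tabulate∣-mono _ _ λ i x∈Fi →
    ⌊⌋≡true⁺ (nonempty? (F i)) (x , lookup⇒[]= x (F i) x∈Fi)

lemma2p4 : (n m : ℕ) → 1 ≤ n → (F : MultiFamily n m) → CondI F → CondII F →
    ∃ (λ (j : Fin n) → 2 ≤ singletonMult F j)
lemma2p4 n m 1≤n F condI condII with any? (λ j → 2 ≤? singletonMult F j)
... | yes repeated = repeated
... | no  none     =
      ⊥-elim (no-common-element (condII (nonemptyMembers F) ∣F₁∣≥2 (⊤ , ⊤∈T* F)))
  where
  ∣F₁∣≥2 : 2 ≤ ∣ nonemptyMembers F ∣
  ∣F₁∣≥2 = ≤-trans (n≤1+n 2) (≤-trans (condI (fromℕ< 1≤n)) (degree≤∣nonemptyMembers∣ F _))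

  mult≤1 : ∀ x → singletonMult F x ≤ 1
  mult≤1 x with 2 ≤? singletonMult F x
  ... | yes twice  = ⊥-elim (none (x , twice))
  ... | no  ¬twice = ≤-pred (≰⇒> ¬twice)

  no-common-element : ¬ ∃ (λ x → ∀ T → InTStar F (nonemptyMembers F) T → x ∈ T)
  no-common-element (x , x∈⋂T*) =
    x∈∁p⇒x∉p (x∈⋂T* (∁ ⁅ x ⁆) (∁⁅x⁆∈T* F x (mult≤1 x))) (x∈⁅x⁆ x)
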